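{- Let $D_n$ ($n\ge 1$) be the Bethe cacti defined below. Then $M(D_1;x,y)=4x^2y^2$, and for every $n\ge 2$, $$M(D_n;x,y)=2\cdot 3^{n-1}x^2y^2+2(3^{n-1}+1)x^2y^4+2(3^{n-1}-2)x^4y^4 .$$
   Context: For a finite simple graph $G$ and integers $i,j\ge 1$, let $m_{i,j}(G)$ be the number of edges $uv$ of $G$ with $\{d_u(G),d_v(G)\}=\{i,j\}$, where $d_v(G)$ is the degree of $v$. The $M$-polynomial of $G$ is $M(G;x,y)=\sum_{i\le j} m_{i,j}(G)\,x^iy^j$. Bethe cacti $D_n$ are rooted graphs defined recursively: $D_1$ is a $4$-cycle with one designated vertex, its root. For $n\ge 2$, take a $4$-cycle with vertices $a,b,c,d$ in cyclic order, declare $a$ to be the root of $D_n$, and take three disjoint copies of $D_{n-1}$; identify the root of the first copy with $b$, the root of the second copy with $c$, and the root of the third copy with $d$. -}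

module Defs where

open import Data.Nat using (ℕ; zero; suc; _+_; _*_; _∸_; _^_; _≡ᵇ_; _≤ᵇ_)
open import Data.Bool using (Bool; true; false; if_then_else_; _∧_; _∨_)
open import Data.Product using (_×_; _,_; proj₁; proj₂)
open import Data.List using (List; []; _∷_; _++_; map; length; filter; foldr)
open import Relation.Nullary.Decidable using (does)
open import Data.Bool using (T?)

-- A finite (multi)graph given by an explicit edge list; the vertex set is
-- {0, …, size - 1}. The graphs built below are simple (no loops, no repeated
-- edges), so this is a faithful encoding of the finite simple graphs D_n.
record Graph : Set where
  constructor mkGraph
  field
    size  : ℕ
    root  : ℕ
    edges : List (ℕ × ℕ)
open Graph public

degree : Graph → ℕ → ℕ
degree G v = length (filter (λ e → T? ((proj₁ e ≡ᵇ v) ∨ (proj₂ e ≡ᵇ v))) (edges G))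

mEdges : Graph → ℕ → ℕ → ℕ
mEdges G i j = length (filter (λ e → T? (match (degree G (proj₁ e)) (degree G (proj₂ e)))) (edges G))
  where
  match : ℕ → ℕ → Bool
  match du dv = ((du ≡ᵇ i) ∧ (dv ≡ᵇ j)) ∨ ((du ≡ᵇ j) ∧ (dv ≡ᵇ i))

-- A bivariate polynomial with ℕ coefficients, given by its coefficient
-- function: P i j = coefficient of x^i y^j.
Poly₂ : Set
Poly₂ = ℕ → ℕ → ℕ

MPoly : Graph → Poly₂
MPoly G i j = if i ≤ᵇ j then mEdges G i j else 0

monomial : ℕ → ℕ → ℕ → Poly₂
monomial c a b i j = if (i ≡ᵇ a) ∧ (j ≡ᵇ b) then c else 0

infixl 6 _⊕_
_⊕_ : Poly₂ → Poly₂ → Poly₂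
(P ⊕ Q) i j = P i j + Q i j

shift : ℕ → Graph → Graph
shift k (mkGraph s r es) = mkGraph s (k + r) (map (λ e → (k + proj₁ e , k + proj₂ e)) es)

cactus : ℕ → Graph
cactus zero = mkGraph 4 0 ((0 , 1) ∷ (1 , 2) ∷ (2 , 3) ∷ (3 , 0) ∷ [])
cactus (suc k) = mkGraph (1 + 3 * s) 0
    ((a , b) ∷ (b , c) ∷ (c , d) ∷ (d , a) ∷ (edges G₁ ++ edges G₂ ++ edges G₃))
  where
  D = cactus k
  s = size D
  G₁ = shift 1 D
  G₂ = shift (1 + s) D
  G₃ = shift (1 + s + s) D
  a = 0
  b = root G₁
  c = root G₂
  d = root G₃

-- D_n for n ≥ 1 (D 0 is an irrelevant placeholder, never used for n = 0)
D : ℕ → Graph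
D n = cactus (n ∸ 1)

module Submission where

-- Every m_{i,j}(G) is a sum over the edges uv of a weight of
-- the degree pair (d_u, d_v), so we study the degree-based index
--   index w f es = Σ_{uv ∈ es} w (f u) (f v)
-- for an arbitrary weight w.  The edge list of D_{k+2} is a square
-- 0-1-(1+s)-(1+2s) glued to three copies of D_{k+1} (on s vertices) shifted
-- to start at the corners 1, 1+s, 1+2s.  The copies occupy disjoint label
-- windows, so a vertex keeps its degree in its copy, except that each copy
-- root gains the 2 square edges ("bump 2").  This gives the recurrence
--   index w (bump b deg) D_{k+2} = square edges + 3 · index w (bump 2 deg) D_{k+1},
-- whose solution expresses the index of D_n for symmetric w through
-- w 2 2, w 2 4, w 4 4 alone.

open import Defs
open import Data.Nat using (ℕ; zero; suc; _+_; _*_; _∸_; _^_; _≤_; _<_; _≡ᵇ_; _≤ᵇ_; z≤n; s≤s)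
open import Data.Nat.Properties
open import Data.Nat.ListAction using (sum)
import Data.Nat.ListAction.Properties as Sum
open import Data.Nat.Tactic.RingSolver using (solve-∀)
open import Data.Bool using (Bool; true; false; if_then_else_; _∧_; _∨_; T?)
open import Data.Bool.Properties using (∧-comm; ∨-comm)
open import Data.Product using (_×_; _,_; proj₁; proj₂)
open import Data.Sum using (_⊎_; inj₁; inj₂)
open import Data.List using (List; []; _∷_; _++_; map; length; filter)
open import Data.List.Properties using (map-++; map-∘; map-cong; map-cong-local)
open import Data.List.Relation.Unary.All as All using (All; []; _∷_)
open import Data.List.Relation.Unary.All.Properties using (++⁺)
open import Relation.Binary.PropositionalEquality
open import Relation.Nullary.Decidable using (dec-false)
open ≡-Reasoning

χ : Bool → ℕ
χ true = 1
χ false = 0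

pick : Bool → ℕ → ℕ
pick b A = if b then A else 0

pick-zero : ∀ b → pick b 0 ≡ 0
pick-zero true = refl
pick-zero false = refl

χ*≡pick : ∀ b A → χ b * A ≡ pick b A
χ*≡pick true A = +-identityʳ A
χ*≡pick false A = refl

cong₄ : ∀ {A B C D E : Set} (f : A → B → C → D → E) {a a′ b b′ c c′ d d′} →
  a ≡ a′ → b ≡ b′ → c ≡ c′ → d ≡ d′ → f a b c d ≡ f a′ b′ c′ d′
cong₄ f refl refl refl refl = refl

≢⇒≡ᵇ-false : ∀ {m n} → m ≢ n → (m ≡ᵇ n) ≡ false
≢⇒≡ᵇ-false {m} {n} m≢n = dec-false (m ≟ n) m≢n

≡ᵇ-+ˡ : ∀ o a x → (o + a ≡ᵇ o + x) ≡ (a ≡ᵇ x)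
≡ᵇ-+ˡ zero a x = refl
≡ᵇ-+ˡ (suc o) a x = ≡ᵇ-+ˡ o a x

≡ᵇ-self-+ : ∀ o x → (o ≡ᵇ o + x) ≡ (x ≡ᵇ 0)
≡ᵇ-self-+ zero zero = refl
≡ᵇ-self-+ zero (suc x) = refl
≡ᵇ-self-+ (suc o) x = ≡ᵇ-self-+ o x

total : ∀ {A : Set} → (A → ℕ) → List A → ℕ
total w xs = sum (map w xs)

total-++ : ∀ {A : Set} (w : A → ℕ) xs ys → total w (xs ++ ys) ≡ total w xs + total w ys
total-++ w xs ys = trans (cong sum (map-++ w xs ys)) (Sum.sum-++ (map w xs) (map w ys))

total-map : ∀ {A B : Set} (w : B → ℕ) (f : A → B) xs → total w (map f xs) ≡ total (λ x → w (f x)) xs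
total-map w f xs = cong sum (sym (map-∘ xs))

total-cong : ∀ {A : Set} {P : A → Set} {w w′ : A → ℕ} {xs} →
  (∀ {x} → P x → w x ≡ w′ x) → All P xs → total w xs ≡ total w′ xs
total-cong eq ps = cong sum (map-cong-local (All.map eq ps))

total-zero : ∀ {A : Set} {w : A → ℕ} {xs} → All (λ x → w x ≡ 0) xs → total w xs ≡ 0
total-zero [] = refl
total-zero (w≡0 ∷ ws) = cong₂ _+_ w≡0 (total-zero ws)

length-filter : ∀ {A : Set} (p : A → Bool) xs →
  length (filter (λ x → T? (p x)) xs) ≡ total (λ x → χ (p x)) xs
length-filter p [] = refl
length-filter p (x ∷ xs) with p x
... | true = cong suc (length-filter p xs)
... | false = length-filter p xs

Edge : Set
Edge = ℕ × ℕ

incident : ℕ → Edge → Bool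
incident v e = (proj₁ e ≡ᵇ v) ∨ (proj₂ e ≡ᵇ v)

deg : List Edge → ℕ → ℕ
deg es v = total (λ e → χ (incident v e)) es

index : (ℕ → ℕ → ℕ) → (ℕ → ℕ) → List Edge → ℕ
index w f es = total (λ e → w (f (proj₁ e)) (f (proj₂ e))) es

index-cong : ∀ w {f g} → (∀ x → f x ≡ g x) → ∀ es → index w f es ≡ index w g es
index-cong w f≗g es = cong sum (map-cong (λ e → cong₂ w (f≗g (proj₁ e)) (f≗g (proj₂ e))) es)

index-++ : ∀ w f xs ys → index w f (xs ++ ys) ≡ index w f xs + index w f ys
index-++ w f = total-++ (λ e → w (f (proj₁ e)) (f (proj₂ e)))

pairB : ℕ → ℕ → ℕ → ℕ → Bool
pairB i j du dv = ((du ≡ᵇ i) ∧ (dv ≡ᵇ j)) ∨ ((du ≡ᵇ j) ∧ (dv ≡ᵇ i))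

pairW : ℕ → ℕ → ℕ → ℕ → ℕ
pairW i j du dv = χ (pairB i j du dv)

pairW-sym : ∀ i j a b → pairW i j a b ≡ pairW i j b a
pairW-sym i j a b = cong χ (trans (∨-comm ((a ≡ᵇ i) ∧ (b ≡ᵇ j)) _)
  (cong₂ _∨_ (∧-comm (a ≡ᵇ j) (b ≡ᵇ i)) (∧-comm (a ≡ᵇ i) (b ≡ᵇ j))))

degree≡deg : ∀ G v → degree G v ≡ deg (edges G) v
degree≡deg G v = length-filter (incident v) (edges G)

mEdges≡index : ∀ G i j → mEdges G i j ≡ index (pairW i j) (deg (edges G)) (edges G)
mEdges≡index G i j =
  trans (length-filter (λ e → pairB i j (degree G (proj₁ e)) (degree G (proj₂ e))) (edges G))
        (index-cong (pairW i j) (degree≡deg G) (edges G))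

sh : ℕ → Edge → Edge
sh o e = (o + proj₁ e , o + proj₂ e)

Bounded : ℕ → List Edge → Set
Bounded s es = All (λ e → proj₁ e < s × proj₂ e < s) es

shift-bounded : ∀ {s N o es} → o + s ≤ N → Bounded s es → Bounded N (map (sh o) es)
shift-bounded o+s≤N [] = []
shift-bounded {o = o} o+s≤N ((a<s , b<s) ∷ bs) =
  (<-≤-trans (+-monoʳ-< o a<s) o+s≤N , <-≤-trans (+-monoʳ-< o b<s) o+s≤N) ∷ shift-bounded o+s≤N bs

Outside : ℕ → ℕ → ℕ → Set
Outside s o v = v < o ⊎ o + s ≤ v

Disjoint : ℕ → ℕ → ℕ → Set
Disjoint s o o′ = o + s ≤ o′ ⊎ o′ + s ≤ o

outside-≢ : ∀ {s o v a} → a < s → Outside s o v → o + a ≢ v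
outside-≢ {o = o} {a = a} a<s (inj₁ v<o) o+a≡v =
  <-irrefl refl (<-≤-trans v<o (≤-trans (m≤m+n o a) (≤-reflexive o+a≡v)))
outside-≢ {o = o} a<s (inj₂ o+s≤v) o+a≡v = <-irrefl o+a≡v (<-≤-trans (+-monoʳ-< o a<s) o+s≤v)

disjoint-outside : ∀ {s o o′ x} → Disjoint s o o′ → x < s → Outside s o′ (o + x)
disjoint-outside {o = o} (inj₁ o+s≤o′) x<s = inj₁ (<-≤-trans (+-monoʳ-< o x<s) o+s≤o′)
disjoint-outside {o = o} {x = x} (inj₂ o′+s≤o) x<s = inj₂ (≤-trans o′+s≤o (m≤m+n o x))

disjoint-corner : ∀ {s o o′ x} → Disjoint s o o′ → x < s → (o′ ≡ᵇ o + x) ≡ false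
disjoint-corner {o′ = o′} d x<s =
  ≢⇒≡ᵇ-false λ o′≡o+x →
    outside-≢ (≤-trans (s≤s z≤n) x<s) (disjoint-outside d x<s) (trans (+-identityʳ o′) o′≡o+x)

deg-shift-self : ∀ o x es → deg (map (sh o) es) (o + x) ≡ deg es x
deg-shift-self o x es = trans (total-map (λ e → χ (incident (o + x) e)) (sh o) es)
  (cong sum (map-cong (λ e → cong χ (cong₂ _∨_ (≡ᵇ-+ˡ o (proj₁ e) x) (≡ᵇ-+ˡ o (proj₂ e) x)))
                      es))

deg-shift-outside : ∀ {s o v es} → Bounded s es → Outside s o v → deg (map (sh o) es) v ≡ 0
deg-shift-outside {o = o} {v} {es} bs out = trans (total-map (λ e → χ (incident v e)) (sh o) es)
  (total-zero (All.map (λ { (a<s , b<s) → cong χ (cong₂ _∨_ (≢⇒≡ᵇ-false (outside-≢ a<s out))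
                                                             (≢⇒≡ᵇ-false (outside-≢ b<s out))) }) bs))

square : ℕ → ℕ → ℕ → ℕ → List Edge
square a b c d = (a , b) ∷ (b , c) ∷ (c , d) ∷ (d , a) ∷ []

squareCount : Bool → Bool → Bool → Bool → ℕ
squareCount A B C D = χ (A ∨ B) + (χ (B ∨ C) + (χ (C ∨ D) + (χ (D ∨ A) + 0)))

twice : Bool → ℕ
twice X = if X then 2 else 0

at-corner-b : ∀ X → squareCount false X false false ≡ twice X
at-corner-b true = refl
at-corner-b false = refl

at-corner-c : ∀ X → squareCount false false X false ≡ twice X
at-corner-c true = refl
at-corner-c false = refl

at-corner-d : ∀ X → squareCount false false false X ≡ twice X
at-corner-d true = refl
at-corner-d false = refl

squareIndex : (ℕ → ℕ → ℕ) → ℕ → ℕ → ℕ → ℕ → ℕ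
squareIndex w p q r t = w p q + (w q r + (w r t + (w t p + 0)))

bump : ℕ → (ℕ → ℕ) → ℕ → ℕ
bump b f x = (if x ≡ᵇ 0 then b else 0) + f x

bump-zero : ∀ f x → bump 0 f x ≡ f x
bump-zero f zero = refl
bump-zero f (suc x) = refl

-- The index of es viewed as a branch whose root carries 2 more edges
-- (the two square edges at the corner where it is attached).
branchIndex : (ℕ → ℕ → ℕ) → List Edge → ℕ
branchIndex w es = index w (bump 2 (deg es)) es

glue : ℕ → List Edge → List Edge
glue s es = square 0 1 (1 + s) (1 + s + s)
  ++ (map (sh 1) es ++ (map (sh (1 + s)) es ++ map (sh (1 + s + s)) es))

glue-bounded : ∀ {s es} → 0 < s → Bounded s es → Bounded (1 + 3 * s) (glue s es)
glue-bounded {s} 0<s bs =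
  (s≤s z≤n , corner 1 o₁) ∷ (corner 1 o₁ , corner (1 + s) o₂) ∷
  (corner (1 + s) o₂ , corner (1 + s + s) o₃) ∷ (corner (1 + s + s) o₃ , s≤s z≤n) ∷
  ++⁺ (shift-bounded o₁ bs) (++⁺ (shift-bounded o₂ bs) (shift-bounded o₃ bs))
  where
  N = 1 + 3 * s
  o₃ : 1 + s + s + s ≤ N
  o₃ = ≤-reflexive (arith s)
    where
    arith : ∀ s → 1 + s + s + s ≡ 1 + 3 * s
    arith = solve-∀
  o₂ : 1 + s + s ≤ N
  o₂ = ≤-trans (m≤m+n (1 + s + s) s) o₃
  o₁ : 1 + s ≤ N
  o₁ = ≤-trans (m≤m+n (1 + s) s) o₂
  corner : ∀ c → c + s ≤ N → c < N
  corner c c+s≤N = <-≤-trans (m<m+n c 0<s) c+s≤N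

module Glued (s : ℕ) (es : List Edge) (bs : Bounded s es) where

  copyEdges : List Edge
  copyEdges = map (sh 1) es ++ (map (sh (1 + s)) es ++ map (sh (1 + s + s)) es)

  copyDeg : ℕ → ℕ
  copyDeg v = deg (map (sh 1) es) v + (deg (map (sh (1 + s)) es) v + deg (map (sh (1 + s + s)) es) v)

  squareDeg : ℕ → ℕ
  squareDeg v = squareCount (0 ≡ᵇ v) (1 ≡ᵇ v) (1 + s ≡ᵇ v) (1 + s + s ≡ᵇ v)

  deg-glue : ∀ v → deg (glue s es) v ≡ squareDeg v + copyDeg v
  deg-glue v = trans (total-++ χv (square 0 1 (1 + s) (1 + s + s)) copyEdges)
    (cong (squareDeg v +_) (trans (total-++ χv (map (sh 1) es) _)
      (cong (deg (map (sh 1) es) v +_) (total-++ χv (map (sh (1 + s)) es) (map (sh (1 + s + s)) es)))))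
    where
    χv = λ e → χ (incident v e)

  deg-glue-root : deg (glue s es) 0 ≡ 2
  deg-glue-root = trans (deg-glue 0) (cong (2 +_)
    (cong₂ _+_ (below 0) (cong₂ _+_ (below s) (below (s + s)))))
    where
    below : ∀ o → deg (map (sh (suc o)) es) 0 ≡ 0
    below o = deg-shift-outside bs (inj₁ (s≤s z≤n))

  private
    in-copy : ∀ o x → squareDeg (o + x) ≡ twice (x ≡ᵇ 0) → copyDeg (o + x) ≡ deg es x →
      deg (glue s es) (o + x) ≡ bump 2 (deg es) x
    in-copy o x sq cp = trans (deg-glue (o + x)) (cong₂ _+_ sq cp)

    other-copy : ∀ {o o′ x} → Disjoint s o o′ → x < s → deg (map (sh o′) es) (o + x) ≡ 0
    other-copy d x<s = deg-shift-outside bs (disjoint-outside d x<s)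

  deg-copy₁ : ∀ x → x < s → deg (glue s es) (1 + x) ≡ bump 2 (deg es) x
  deg-copy₁ x x<s = in-copy 1 x
    (trans (cong₄ squareCount {a = false} refl (≡ᵇ-self-+ 1 x) (disjoint-corner d₂ x<s) (disjoint-corner d₃ x<s))
           (at-corner-b (x ≡ᵇ 0)))
    (trans (cong₂ _+_ (deg-shift-self 1 x es) (cong₂ _+_ (other-copy d₂ x<s) (other-copy d₃ x<s)))
           (+-identityʳ _))
    where
    d₂ : Disjoint s 1 (1 + s)
    d₂ = inj₁ ≤-refl
    d₃ : Disjoint s 1 (1 + s + s)
    d₃ = inj₁ (m≤m+n (1 + s) s)

  deg-copy₂ : ∀ x → x < s → deg (glue s es) (1 + s + x) ≡ bump 2 (deg es) x
  deg-copy₂ x x<s = in-copy (1 + s) x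
    (trans (cong₄ squareCount {a = false} refl (disjoint-corner d₁ x<s) (≡ᵇ-self-+ (1 + s) x) (disjoint-corner d₃ x<s))
           (at-corner-c (x ≡ᵇ 0)))
    (trans (cong₂ _+_ (other-copy d₁ x<s) (cong₂ _+_ (deg-shift-self (1 + s) x es) (other-copy d₃ x<s)))
           (+-identityʳ _))
    where
    d₁ : Disjoint s (1 + s) 1
    d₁ = inj₂ ≤-refl
    d₃ : Disjoint s (1 + s) (1 + s + s)
    d₃ = inj₁ ≤-refl

  deg-copy₃ : ∀ x → x < s → deg (glue s es) (1 + s + s + x) ≡ bump 2 (deg es) x
  deg-copy₃ x x<s = in-copy (1 + s + s) x
    (trans (cong₄ squareCount {a = false} refl (disjoint-corner d₁ x<s) (disjoint-corner d₂ x<s) (≡ᵇ-self-+ (1 + s + s) x))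
           (at-corner-d (x ≡ᵇ 0)))
    (cong₂ _+_ (other-copy d₁ x<s) (cong₂ _+_ (other-copy d₂ x<s) (deg-shift-self (1 + s + s) x es)))
    where
    d₁ : Disjoint s (1 + s + s) 1
    d₁ = inj₂ (m≤m+n (1 + s) s)
    d₂ : Disjoint s (1 + s + s) (1 + s)
    d₂ = inj₂ ≤-refl

  index-glue : ∀ w b → 0 < s → deg es 0 ≡ 2 →
    index w (bump b (deg (glue s es))) (glue s es)
      ≡ squareIndex w (b + 2) 4 4 4 + (branchIndex w es + (branchIndex w es + branchIndex w es))
  index-glue w b 0<s root2 = begin
    index w f (glue s es)
      ≡⟨ index-++ w f (square 0 1 (1 + s) (1 + s + s)) copyEdges ⟩
    squareIndex w (f 0) (f 1) (f (1 + s)) (f (1 + s + s)) + index w f copyEdges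
      ≡⟨ cong₂ _+_ (cong₄ (squareIndex w) (cong (b +_) deg-glue-root) four₁ four₂ four₃) copies-index ⟩
    squareIndex w (b + 2) 4 4 4 + (branchIndex w es + (branchIndex w es + branchIndex w es)) ∎
    where
    f = bump b (deg (glue s es))
    root-bumped : ∀ {v} → v ≡ bump 2 (deg es) 0 → v ≡ 4
    root-bumped v≡ = trans v≡ (cong (2 +_) root2)
    four₁ : f 1 ≡ 4
    four₁ = root-bumped (deg-copy₁ 0 0<s)
    four₂ : f (1 + s) ≡ 4
    four₂ = root-bumped (trans (cong (deg (glue s es)) (sym (+-identityʳ (1 + s)))) (deg-copy₂ 0 0<s))
    four₃ : f (1 + s + s) ≡ 4
    four₃ = root-bumped (trans (cong (deg (glue s es)) (sym (+-identityʳ (1 + s + s)))) (deg-copy₃ 0 0<s))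
    -- every copy is shifted by a positive offset, so bump b does not touch it
    copy-index : ∀ o → (∀ x → x < s → deg (glue s es) (suc o + x) ≡ bump 2 (deg es) x) →
      index w f (map (sh (suc o)) es) ≡ branchIndex w es
    copy-index o deg-copy = trans (total-map _ (sh (suc o)) es)
      (total-cong (λ { (a<s , b<s) → cong₂ w (deg-copy _ a<s) (deg-copy _ b<s) }) bs)
    copies-index : index w f copyEdges ≡ branchIndex w es + (branchIndex w es + branchIndex w es)
    copies-index = trans (index-++ w f (map (sh 1) es) _) (cong₂ _+_ (copy-index 0 deg-copy₁)
      (trans (index-++ w f (map (sh (1 + s)) es) (map (sh (1 + s + s)) es))
             (cong₂ _+_ (copy-index s deg-copy₂) (copy-index (s + s) deg-copy₃))))

E : ℕ → List Edge
E k = edges (cactus k)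

cactus-root : ∀ k → root (cactus k) ≡ 0
cactus-root zero = refl
cactus-root (suc k) = refl

cactus-size-pos : ∀ k → 0 < size (cactus k)
cactus-size-pos zero = s≤s z≤n
cactus-size-pos (suc k) = s≤s z≤n

cactus-edges : ∀ k → E (suc k) ≡ glue (size (cactus k)) (E k)
cactus-edges k rewrite cactus-root k
  | +-identityʳ (1 + size (cactus k)) | +-identityʳ (1 + size (cactus k) + size (cactus k)) = refl

cactus-bounded : ∀ k → Bounded (size (cactus k)) (E k)
cactus-bounded zero = (0<4 , 1<4) ∷ (1<4 , 2<4) ∷ (2<4 , 3<4) ∷ (3<4 , 0<4) ∷ []
  where
  3<4 : 3 < 4
  3<4 = n<1+n 3
  2<4 : 2 < 4
  2<4 = m<n⇒m<1+n (n<1+n 2)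
  1<4 : 1 < 4
  1<4 = m<n⇒m<1+n (m<n⇒m<1+n (n<1+n 1))
  0<4 : 0 < 4
  0<4 = s≤s z≤n
cactus-bounded (suc k) rewrite cactus-edges k = glue-bounded (cactus-size-pos k) (cactus-bounded k)

cactus-root-deg : ∀ k → deg (E k) 0 ≡ 2
cactus-root-deg zero = refl
cactus-root-deg (suc k) =
  subst (λ L → deg L 0 ≡ 2) (sym (cactus-edges k)) (Glued.deg-glue-root _ (E k) (cactus-bounded k))

index-step : ∀ w b k →
  index w (bump b (deg (E (suc k)))) (E (suc k))
    ≡ squareIndex w (b + 2) 4 4 4 + (branchIndex w (E k) + (branchIndex w (E k) + branchIndex w (E k)))
index-step w b k = subst (λ L → index w (bump b (deg L)) L ≡ squareIndex w (b + 2) 4 4 4 + (B + (B + B)))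
  (sym (cactus-edges k))
  (Glued.index-glue _ (E k) (cactus-bounded k) w b (cactus-size-pos k) (cactus-root-deg k))
  where
  B = branchIndex w (E k)

branch-closed : ∀ w → w 4 2 ≡ w 2 4 → ∀ k →
  branchIndex w (E k) + 2 * w 4 4 ≡ 2 * 3 ^ k * (w 2 2 + w 2 4 + w 4 4)
branch-closed w sym₄₂ zero rewrite sym₄₂ = arith (w 2 2) (w 2 4) (w 4 4)
  where
  arith : ∀ a b c → b + (a + (a + (b + 0))) + 2 * c ≡ 2 * 1 * (a + b + c)
  arith = solve-∀
branch-closed w sym₄₂ (suc k) = begin
  branchIndex w (E (suc k)) + 2 * w 4 4
    ≡⟨ cong (_+ 2 * w 4 4) (index-step w 2 k) ⟩
  squareIndex w 4 4 4 4 + (B + (B + B)) + 2 * w 4 4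
    ≡⟨ arith (w 4 4) B ⟩
  3 * (B + 2 * w 4 4)
    ≡⟨ cong (3 *_) (branch-closed w sym₄₂ k) ⟩
  3 * (2 * 3 ^ k * S)
    ≡⟨ arith′ (3 ^ k) S ⟩
  2 * 3 ^ suc k * S ∎
  where
  B = branchIndex w (E k)
  S = w 2 2 + w 2 4 + w 4 4
  arith : ∀ c B → c + (c + (c + (c + 0))) + (B + (B + B)) + 2 * c ≡ 3 * (B + 2 * c)
  arith = solve-∀
  arith′ : ∀ t S → 3 * (2 * t * S) ≡ 2 * (3 * t) * S
  arith′ = solve-∀

cactus-index : ∀ w → w 4 2 ≡ w 2 4 → ∀ k → let p = 3 ^ suc k in
  index w (deg (E (suc k))) (E (suc k)) + w 4 4 * 4
    ≡ w 2 2 * (2 * p) + w 2 4 * (2 * (p + 1)) + w 4 4 * (2 * p)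
cactus-index w sym₄₂ k = begin
  index w (deg (E (suc k))) (E (suc k)) + w 4 4 * 4
    ≡⟨ cong (_+ w 4 4 * 4) (sym (index-cong w (bump-zero (deg (E (suc k)))) (E (suc k)))) ⟩
  index w (bump 0 (deg (E (suc k)))) (E (suc k)) + w 4 4 * 4
    ≡⟨ cong (_+ w 4 4 * 4) (index-step w 0 k) ⟩
  w 2 4 + (c + (c + (w 4 2 + 0))) + (B + (B + B)) + c * 4
    ≡⟨ cong (λ z → w 2 4 + (c + (c + (z + 0))) + (B + (B + B)) + c * 4) sym₄₂ ⟩
  w 2 4 + (c + (c + (w 2 4 + 0))) + (B + (B + B)) + c * 4
    ≡⟨ arith (w 2 4) c B ⟩
  2 * w 2 4 + 3 * (B + 2 * c)
    ≡⟨ cong (λ z → 2 * w 2 4 + 3 * z) (branch-closed w sym₄₂ k) ⟩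
  2 * w 2 4 + 3 * (2 * 3 ^ k * (w 2 2 + w 2 4 + c))
    ≡⟨ arith′ (w 2 2) (w 2 4) c (3 ^ k) ⟩
  w 2 2 * (2 * 3 ^ suc k) + w 2 4 * (2 * (3 ^ suc k + 1)) + c * (2 * 3 ^ suc k) ∎
  where
  c = w 4 4
  B = branchIndex w (E k)
  arith : ∀ b c B → b + (c + (c + (b + 0))) + (B + (B + B)) + c * 4 ≡ 2 * b + 3 * (B + 2 * c)
  arith = solve-∀
  arith′ : ∀ a b c t → 2 * b + 3 * (2 * t * (a + b + c))
                     ≡ a * (2 * (3 * t)) + b * (2 * (3 * t + 1)) + c * (2 * (3 * t))
  arith′ = solve-∀

-- Only the labels
-- 0, …, 4 matter, so this is a finite check (labels ≥ 5 are lumped).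
coefficients : ∀ i j A B C →
  (if i ≤ᵇ j then pick (pairB i j 2 2) A + pick (pairB i j 2 4) B + pick (pairB i j 4 4) C else 0)
    ≡ (monomial A 2 2 ⊕ monomial B 2 4 ⊕ monomial C 4 4) i j
coefficients 0 0 A B C = refl
coefficients 0 1 A B C = refl
coefficients 0 2 A B C = refl
coefficients 0 3 A B C = refl
coefficients 0 4 A B C = refl
coefficients 0 (suc (suc (suc (suc (suc j))))) A B C = refl
coefficients 1 0 A B C = refl
coefficients 1 1 A B C = refl
coefficients 1 2 A B C = refl
coefficients 1 3 A B C = refl
coefficients 1 4 A B C = refl
coefficients 1 (suc (suc (suc (suc (suc j))))) A B C = refl
coefficients 2 0 A B C = refl
coefficients 2 1 A B C = refl
coefficients 2 2 A B C = refl
coefficients 2 3 A B C = refl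
coefficients 2 4 A B C = refl
coefficients 2 (suc (suc (suc (suc (suc j))))) A B C = refl
coefficients 3 0 A B C = refl
coefficients 3 1 A B C = refl
coefficients 3 2 A B C = refl
coefficients 3 3 A B C = refl
coefficients 3 4 A B C = refl
coefficients 3 (suc (suc (suc (suc (suc j))))) A B C = refl
coefficients 4 0 A B C = refl
coefficients 4 1 A B C = refl
coefficients 4 2 A B C = refl
coefficients 4 3 A B C = refl
coefficients 4 4 A B C = refl
coefficients 4 (suc (suc (suc (suc (suc j))))) A B C = refl
coefficients (suc (suc (suc (suc (suc i))))) 0 A B C = refl
coefficients (suc (suc (suc (suc (suc i))))) 1 A B C = refl
coefficients (suc (suc (suc (suc (suc i))))) 2 A B C = refl
coefficients (suc (suc (suc (suc (suc i))))) 3 A B C = refl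
coefficients (suc (suc (suc (suc (suc i))))) 4 A B C = refl
coefficients i@(suc (suc (suc (suc (suc _))))) j@(suc (suc (suc (suc (suc _))))) A B C = pick-zero (i ≤ᵇ j)

MPoly-from-counts : ∀ G i j A B C →
  mEdges G i j ≡ pick (pairB i j 2 2) A + pick (pairB i j 2 4) B + pick (pairB i j 4 4) C →
  MPoly G i j ≡ (monomial A 2 2 ⊕ monomial B 2 4 ⊕ monomial C 4 4) i j
MPoly-from-counts G i j A B C counts =
  trans (cong (λ m → if i ≤ᵇ j then m else 0) counts) (coefficients i j A B C)

-- The {4,4} term: the closed form carries 4 extra copies of w 4 4 on the left.
cancel-44 : ∀ {m} U c p → 2 ≤ p → m + pick c 4 ≡ U + pick c (2 * p) → m ≡ U + pick c (2 * (p ∸ 2))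
cancel-44 {m} U false p 2≤p eq = trans (sym (+-identityʳ m)) eq
cancel-44 {m} U true (suc (suc r)) (s≤s (s≤s z≤n)) eq = +-cancelʳ-≡ 4 m (U + 2 * r) (trans eq (arith U r))
  where
  arith : ∀ U r → U + 2 * (2 + r) ≡ U + 2 * r + 4
  arith = solve-∀

-- Needed to subtract the 4 extra {4,4} edges: 3^{k+1} ≥ 2.
three^-≥2 : ∀ k → 2 ≤ 3 ^ suc k
three^-≥2 k = ≤-trans (s≤s (s≤s z≤n)) (*-monoʳ-≤ 3 (m^n>0 3 k))

cactus-counts : ∀ k i j → let p = 3 ^ suc k in
  mEdges (cactus (suc k)) i j
    ≡ pick (pairB i j 2 2) (2 * p) + pick (pairB i j 2 4) (2 * (p + 1)) + pick (pairB i j 4 4) (2 * (p ∸ 2))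
cactus-counts k i j =
  trans (mEdges≡index (cactus (suc k)) i j) (cancel-44 _ b₄₄ p (three^-≥2 k) closed)
  where
  w = pairW i j
  p = 3 ^ suc k
  b₂₂ = pairB i j 2 2
  b₂₄ = pairB i j 2 4
  b₄₄ = pairB i j 4 4
  I = index w (deg (E (suc k))) (E (suc k))
  closed : I + pick b₄₄ 4 ≡ pick b₂₂ (2 * p) + pick b₂₄ (2 * (p + 1)) + pick b₄₄ (2 * p)
  closed = begin
    I + pick b₄₄ 4
      ≡⟨ cong (I +_) (sym (χ*≡pick b₄₄ 4)) ⟩
    I + w 4 4 * 4
      ≡⟨ cactus-index w (pairW-sym i j 4 2) k ⟩
    w 2 2 * (2 * p) + w 2 4 * (2 * (p + 1)) + w 4 4 * (2 * p)
      ≡⟨ cong₂ _+_ (cong₂ _+_ (χ*≡pick b₂₂ (2 * p)) (χ*≡pick b₂₄ (2 * (p + 1)))) (χ*≡pick b₄₄ (2 * p)) ⟩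
    pick b₂₂ (2 * p) + pick b₂₄ (2 * (p + 1)) + pick b₄₄ (2 * p) ∎

M-D₁ : (i j : ℕ) → MPoly (D 1) i j ≡ monomial 4 2 2 i j
M-D₁ i j = begin
  MPoly (D 1) i j
    ≡⟨ MPoly-from-counts (D 1) i j 4 0 0
         (trans (mEdges≡index (D 1) i j) (four-edges (pairB i j 2 2) (pairB i j 2 4) (pairB i j 4 4))) ⟩
  monomial 4 2 2 i j + monomial 0 2 4 i j + monomial 0 4 4 i j
    ≡⟨ cong₂ _+_ (cong (monomial 4 2 2 i j +_) (pick-zero _)) (pick-zero _) ⟩
  monomial 4 2 2 i j + 0 + 0
    ≡⟨ trans (+-identityʳ _) (+-identityʳ _) ⟩
  monomial 4 2 2 i j ∎
  where
  four-edges : ∀ a b c → χ a + (χ a + (χ a + (χ a + 0))) ≡ pick a 4 + pick b 0 + pick c 0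
  four-edges true b c = sym (cong₂ _+_ (cong (4 +_) (pick-zero b)) (pick-zero c))
  four-edges false b c = sym (cong₂ _+_ (cong (0 +_) (pick-zero b)) (pick-zero c))

M-Dₙ : (n : ℕ) → 2 ≤ n → (i j : ℕ) →
  MPoly (D n) i j
    ≡ (monomial (2 * 3 ^ (n ∸ 1)) 2 2
       ⊕ monomial (2 * (3 ^ (n ∸ 1) + 1)) 2 4
       ⊕ monomial (2 * (3 ^ (n ∸ 1) ∸ 2)) 4 4) i j
M-Dₙ (suc (suc k)) (s≤s (s≤s z≤n)) i j =
  MPoly-from-counts (cactus (suc k)) i j _ _ _ (cactus-counts k i j)

theorem3p1 : ((i j : ℕ) → MPoly (D 1) i j ≡ monomial 4 2 2 i j)
    × ((n : ℕ) → 2 ≤ n → (i j : ℕ) →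
    MPoly (D n) i j
    ≡ (monomial (2 * 3 ^ (n ∸ 1)) 2 2
    ⊕ monomial (2 * (3 ^ (n ∸ 1) + 1)) 2 4
    ⊕ monomial (2 * (3 ^ (n ∸ 1) ∸ 2)) 4 4) i j)
theorem3p1 = M-D₁ , M-Dₙ
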